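{- Let $k\geq 1$ and $X=\{x_1,\dots,x_k\}$. Define $$V_k(x_1,\dots,x_k)=\sum_{n_1,\dots,n_k\geq 1}\frac{\prod_{j=1}^{k-1}\min(n_j,n_{j+1})}{n_1^{x_1}n_2^{x_2}\cdots n_k^{x_k}}.$$ Then $$V_k(x_1,\dots,x_k)=\sum_{S\in S(X)}\zeta_{l}(e_1,\dots,e_l),$$ where for each ordered partition $S=(S_1,\dots,S_l)$ of $X$ (with $l$ its number of blocks) and each $1\le i\le l$, $$e_i=\sum_{j:\,x_j\in S_i}\big(x_j-f_{i,j}^{+}-f_{i,j}^{ - }\big),$$ with $f_{i,j}^{+}=1$ if $j+1\le k$ and $x_{j+1}\in S_t$ for some $1\le t\le i-1$, and $f_{i,j}^{+}=0$ otherwise; and $f_{i,j}^{ - }=1$ if $j-1\ge 1$ and $x_{j-1}\in S_t$ for some $1\le t\le i$, and $f_{i,j}^{ - }=0$ otherwise. The identity holds as an identity of formal multiple Dirichlet series (equivalently, for all complex $x_1,\dots,x_k$ for which the series defining $V_k$ converges absolutely).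
   Context: $V_k$ is the Dirichlet generating function of parallelogram polyominoes of width $k$, with $x_i$ marking the height of the $i$-th column. $S(X)$ denotes the set of all ordered set partitions of the finite set $X$, i.e. all sequences $(S_1,\dots,S_l)$ of nonempty pairwise disjoint subsets of $X$ whose union is $X$, with $l\geq 1$ arbitrary. For $l\ge1$, the multiple zeta function is $\zeta_l(e_1,\dots,e_l)=\sum_{n_1>n_2>\dots>n_l\geq 1}\frac{1}{n_1^{e_1}n_2^{e_2}\cdots n_l^{e_l}}$. -}

module Defs where

open import Data.Nat using (ℕ; zero; suc; _+_; _*_; _^_; _⊓_; _≤ᵇ_; _<ᵇ_; _≡ᵇ_)
open import Data.Bool using (Bool; true; false; if_then_else_; _∧_)
open import Data.Fin using (Fin; toℕ)
open import Data.List using (List; []; _∷_; map; concatMap; filterᵇ; allFin; upTo)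
open import Data.Nat.ListAction using (sum; product)
open import Data.Bool.ListAction using (all; any)
import Data.Vec.Functional as VF

-- Formal multiple Dirichlet series in k variables x_1..x_k with ℕ
-- coefficients:  F = Σ_{n_1..n_k ≥ 1} F(n) · n_1^{-x_1} ⋯ n_k^{-x_k}.
-- It is represented by its coefficient function; only arguments n with
-- all n_j ≥ 1 are meaningful.
FDS : ℕ → Set
FDS k = (Fin k → ℕ) → ℕ

sumFDS : ∀ {k} → List (FDS k) → FDS k
sumFDS Fs n = sum (map (λ F → F n) Fs)

adjMinProd : List ℕ → ℕ
adjMinProd (a ∷ b ∷ rest) = (a ⊓ b) * adjMinProd (b ∷ rest)
adjMinProd _ = 1

V : (k : ℕ) → FDS k
V k n = adjMinProd (VF.toList n)

consF : ∀ {k m} → Fin m → (Fin k → Fin m) → (Fin (suc k) → Fin m)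
consF a f Fin.zero = a
consF a f (Fin.suc i) = f i

allFuns : (k m : ℕ) → List (Fin k → Fin m)
allFuns zero m = (λ ()) ∷ []
allFuns (suc k) m = concatMap (λ f → map (λ a → consF a f) (allFin m)) (allFuns k m)

_≟ᶠ_ : ∀ {m} → Fin m → Fin m → Bool
i ≟ᶠ j = toℕ i ≡ᵇ toℕ j

-- Ordered set partitions (S_1,…,S_l) of X = {x_1..x_k}, represented by
-- the block map b : Fin k → Fin l (x_j ∈ S_{b j + 1}), which must be
-- surjective (all blocks nonempty).
record OSP (k : ℕ) : Set where
  constructor osp
  field
    l     : ℕ
    block : Fin k → Fin l
open OSP public

isSurj : ∀ {k l} → (Fin k → Fin l) → Bool
isSurj {k} {l} b = all (λ i → any (λ j → b j ≟ᶠ i) (allFin k)) (allFin l)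

-- S(X): all ordered set partitions, l ranging over 1..k
-- (a surjection Fin k → Fin l forces l ≤ k, and l ≥ 1 since k ≥ 1 below).
orderedSetPartitions : (k : ℕ) → List (OSP k)
orderedSetPartitions k =
  concatMap (λ l → map (osp (suc l)) (filterᵇ isSurj (allFuns k (suc l))))
            (upTo k)

fplus : ∀ {k l} → (Fin k → Fin l) → Fin k → ℕ
fplus {k} b j =
  if any (λ j' → (toℕ j' ≡ᵇ suc (toℕ j)) ∧ (toℕ (b j') <ᵇ toℕ (b j))) (allFin k)
  then 1 else 0

fminus : ∀ {k l} → (Fin k → Fin l) → Fin k → ℕ
fminus {k} b j =
  if any (λ j' → (suc (toℕ j') ≡ᵇ toℕ j) ∧ (toℕ (b j') ≤ᵇ toℕ (b j))) (allFin k)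
  then 1 else 0

-- e_i = Σ_{x_j ∈ S_i} x_j − shift_i, with shift_i = Σ_{x_j ∈ S_i} (f⁺ + f⁻).
shift : ∀ {k l} → (Fin k → Fin l) → Fin l → ℕ
shift {k} b i =
  sum (map (λ j → if b j ≟ᶠ i then fplus b j + fminus b j else 0) (allFin k))

-- The formal series ζ_l(e_1,…,e_l)
--   = Σ_{m_1 > ⋯ > m_l ≥ 1} Π_i m_i^{-e_i}
--   = Σ_{m_1 > ⋯ > m_l ≥ 1} (Π_i m_i^{shift_i}) · Π_j m_{b j}^{-x_j}.
-- Its coefficient at (n_1..n_k) is the sum of Π_i m_i^{shift_i} over the
-- strictly decreasing m with m_{b j} = n_j for all j.  Since b is
-- surjective, every such m takes values among the n_j, so it suffices to
-- let m range over (Fin l → {1..B}) with B = Σ_j n_j (≥ every n_j).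

strictDecr : ∀ {l} → (Fin l → ℕ) → Bool
strictDecr {l} m =
  all (λ i → all (λ i' → if toℕ i <ᵇ toℕ i' then m i' <ᵇ m i else true)
                 (allFin l)) (allFin l)

zetaTerm : ∀ {k} → (p : OSP k) → (n : Fin k → ℕ) → (Fin (l p) → ℕ) → ℕ
zetaTerm {k} (osp l b) n m =
  if strictDecr m ∧ all (λ j → m (b j) ≡ᵇ n j) (allFin k)
  then product (map (λ i → m i ^ shift b i) (allFin l))
  else 0

Zeta : ∀ {k} → OSP k → FDS k
Zeta {k} (osp l b) n =
  sum (map (λ m' → zetaTerm (osp l b) n (λ i → suc (toℕ (m' i))))
           (allFuns l (sum (VF.toList n))))

RHS : (k : ℕ) → FDS k
RHS k = sumFDS (map Zeta (orderedSetPartitions k))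

-- Fix positive heights n = (n_1, …, n_k) and compare the coefficients of
-- n_1^(-x_1) ⋯ n_k^(-x_k) on both sides.  A term of ζ_S, with S written as the
-- block map j ↦ b(j) and summation variables m_1 > ⋯ > m_l, produces this
-- monomial exactly when m_(b(j)) = n_j for all j.  Such a pair (S, m) exists
-- and is unique: m lists the distinct heights in decreasing order, and b(j) is
-- the position of n_j in that list.  For it, x_(j+1) lies in an earlier block
-- exactly when n_(j+1) > n_j, and x_(j-1) in an earlier or the same block
-- exactly when n_(j-1) ≥ n_j; so the coefficient Π_i m_i^(Σ_{j ∈ S_i} f⁺ + f⁻)
-- equals Π_j n_j^([n_j < n_(j+1)] + [n_j ≤ n_(j-1)]).  In this product every
-- adjacent pair (j, j+1) contributes exactly min(n_j, n_(j+1)), which is the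
-- coefficient of V_k.

module Submission where

open import Defs
open import Algebra.Bundles using (Monoid)
import Algebra.Properties.CommutativeMonoid.Sum as CommutativeMonoidSum
import Algebra.Properties.Monoid.Sum as MonoidSum
open import Data.Bool using (Bool; true; false; T; if_then_else_; _∧_; _∨_)
open import Data.Bool.ListAction using (all; any; or)
open import Data.Bool.Properties using (∨-identityʳ; T-≡; T-∧)
open import Data.Empty using (⊥; ⊥-elim)
open import Data.Fin using (Fin; zero; suc; toℕ; fromℕ<) renaming (_<_ to _<ᶠ_)
import Data.Fin.Properties as Fin
open import Data.List
  using (List; []; _∷_; _++_; foldr; map; concatMap; filter; filterᵇ; tabulate; allFin;
         applyUpTo; upTo; downFrom; length; lookup)
open import Data.List.Membership.Propositional using (_∈_)
open import Data.List.Membership.Propositional.Properties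
  using (∈-tabulate⁺; ∈-tabulate⁻; ∈-filter⁺; ∈-filter⁻; ∈-downFrom⁺; ∈-lookup)
open import Data.List.Properties
  using (map-tabulate; map-cong; map-++; map-∘; map-upTo; length-tabulate; ∷-injective)
open import Data.List.Relation.Binary.Subset.Propositional using (_⊆_)
open import Data.List.Relation.Unary.All as All using (All)
import Data.List.Relation.Unary.All.Properties as All
open import Data.List.Relation.Unary.AllPairs using (AllPairs; _∷_)
import Data.List.Relation.Unary.AllPairs.Properties as AllPairs
open import Data.List.Relation.Unary.Any using (here; there; index)
import Data.List.Relation.Unary.Any.Properties as Any
open import Data.Nat
  using (ℕ; zero; suc; _+_; _*_; _^_; _⊓_; _≤_; _<_; _>_; s≤s; _≡ᵇ_; _<ᵇ_; _≤ᵇ_)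
import Data.Nat.ListAction as List
open import Data.Nat.ListAction.Properties using (sum-++)
open import Data.Nat.Properties
open import Data.Nat.Tactic.RingSolver using (solve-∀)
open import Data.Product using (∃; _×_; _,_; proj₁; proj₂)
open import Data.Vec.Functional using (Vector)
open import Function using (_∘_; _⇔_; mk⇔; Equivalence; Injective; StrictlySurjective)
open import Relation.Binary.Core using (_Preserves_⟶_)
open import Relation.Binary.Definitions using (tri<; tri≈; tri>)
open import Relation.Binary.PropositionalEquality
open import Relation.Nullary using (¬_; contradiction)
open import Relation.Unary using (Decidable)

private variable X Y : Set

iverson : Bool → ℕ
iverson c = if c then 1 else 0

T-injective : ∀ {a b} → (T a → T b) → (T b → T a) → a ≡ b
T-injective {false} {false} _   _   = refl
T-injective {false} {true}  _   b⇒a = ⊥-elim (b⇒a _)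
T-injective {true}  {false} a⇒b _   = ⊥-elim (a⇒b _)
T-injective {true}  {true}  _   _   = refl

if-T : ∀ {c} (x y : X) → T c → (if c then x else y) ≡ x
if-T {c = true} x y _ = refl

if-¬T : ∀ {c} (x y : X) → ¬ T c → (if c then x else y) ≡ y
if-¬T {c = true}  x y ¬c = ⊥-elim (¬c _)
if-¬T {c = false} x y ¬c = refl

T-≟ᶠ : ∀ {l} {i j : Fin l} → T (i ≟ᶠ j) ⇔ i ≡ j
T-≟ᶠ = mk⇔ (Fin.toℕ-injective ∘ ≡ᵇ⇒≡ _ _) (≡⇒≡ᵇ _ _ ∘ cong toℕ)

if-≟ᶠ-refl : ∀ {l} (i : Fin l) (x y : X) → (if i ≟ᶠ i then x else y) ≡ x
if-≟ᶠ-refl i x y = if-T x y (Equivalence.from (T-≟ᶠ {i = i}) refl)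

if-≟ᶠ-≢ : ∀ {l} {i j : Fin l} (x y : X) → i ≢ j → (if i ≟ᶠ j then x else y) ≡ y
if-≟ᶠ-≢ x y i≢j = if-¬T x y (i≢j ∘ Equivalence.to T-≟ᶠ)

T-all-allFin : ∀ {n} (p : Fin n → Bool) → T (all p (allFin n)) ⇔ (∀ i → T (p i))
T-all-allFin p = mk⇔ (All.tabulate⁻ ∘ All.all⁺ p _) (All.all⁻ p ∘ All.tabulate⁺)

T-any-allFin : ∀ {n} (p : Fin n → Bool) → T (any p (allFin n)) ⇔ ∃ λ i → T (p i)
T-any-allFin p = mk⇔ (Any.tabulate⁻ ∘ Any.any⁻ p _) (λ (i , pi) → Any.any⁺ p (Any.tabulate⁺ i pi))

T-isSurj : ∀ {k l} (b : Fin k → Fin l) → T (isSurj b) ⇔ StrictlySurjective _≡_ b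
T-isSurj b = mk⇔
  (λ t i → let j , t′ = Equivalence.to (T-any-allFin _) (Equivalence.to (T-all-allFin _) t i)
           in j , Equivalence.to T-≟ᶠ t′)
  (λ onto → Equivalence.from (T-all-allFin _) λ i → let j , bj≡i = onto i in
     Equivalence.from (T-any-allFin _) (j , Equivalence.from T-≟ᶠ bj≡i))

module _ {a ℓ} (M : Monoid a ℓ) where
  open Monoid M using (Carrier; _≈_; _∙_; ε; ∙-congˡ; ∙-congʳ; identityˡ; identityʳ)
    renaming (refl to ≈-refl; trans to ≈-trans)
  open MonoidSum M

  foldr-tabulate : ∀ {n} (f : Vector Carrier n) → foldr _∙_ ε (tabulate f) ≈ sum f
  foldr-tabulate {zero}  f = ≈-refl
  foldr-tabulate {suc n} f = ∙-congˡ (foldr-tabulate (f ∘ suc))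

  sum-ε : ∀ {n} (f : Vector Carrier n) → (∀ i → f i ≈ ε) → sum f ≈ ε
  sum-ε {n} f f≈ε = ≈-trans (sum-cong-≋ f≈ε) (sum-replicate-zero n)

  sum-single : ∀ {n} (f : Vector Carrier n) i → (∀ j → j ≢ i → f j ≈ ε) → sum f ≈ f i
  sum-single f zero    f≈ε =
    ≈-trans (∙-congˡ (sum-ε (f ∘ suc) (λ j → f≈ε (suc j) λ ()))) (identityʳ _)
  sum-single f (suc i) f≈ε = ≈-trans (∙-congʳ (f≈ε zero λ ()))
    (≈-trans (identityˡ _) (sum-single (f ∘ suc) i (λ j j≢i → f≈ε (suc j) (j≢i ∘ Fin.suc-injective))))

module Additive = CommutativeMonoidSum +-0-commutativeMonoid
module Multiplicative = CommutativeMonoidSum *-1-commutativeMonoid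

∑ ∏ : ∀ {n} → (Fin n → ℕ) → ℕ
∑ = Additive.sum
∏ = Multiplicative.sum

^-∑ : ∀ x {n} (f : Fin n → ℕ) → x ^ ∑ f ≡ ∏ (λ i → x ^ f i)
^-∑ x {zero}  f = refl
^-∑ x {suc n} f = trans (^-distribˡ-+-* x (f zero) _) (cong (x ^ f zero *_) (^-∑ x (f ∘ suc)))

sum-map-allFin : ∀ {n} (f : Fin n → ℕ) → List.sum (map f (allFin n)) ≡ ∑ f
sum-map-allFin f = trans (cong List.sum (map-tabulate (λ i → i) f)) (foldr-tabulate +-0-monoid f)

product-map-allFin : ∀ {n} (f : Fin n → ℕ) → List.product (map f (allFin n)) ≡ ∏ f
product-map-allFin f = trans (cong List.product (map-tabulate (λ i → i) f)) (foldr-tabulate *-1-monoid f)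

sum-map-map-allFin : ∀ {n} (f : X → ℕ) (g : Fin n → X) → List.sum (map f (map g (allFin n))) ≡ ∑ (f ∘ g)
sum-map-map-allFin {n = n} f g =
  trans (cong List.sum (sym (map-∘ {g = f} {f = g} (allFin n)))) (sum-map-allFin (f ∘ g))

sum-applyUpTo : ∀ (f : ℕ → ℕ) n → List.sum (applyUpTo f n) ≡ ∑ {n} (f ∘ toℕ)
sum-applyUpTo f zero    = refl
sum-applyUpTo f (suc n) = cong (f 0 +_) (sum-applyUpTo (f ∘ suc) n)

sum-map-upTo : ∀ (f : ℕ → ℕ) n → List.sum (map f (upTo n)) ≡ ∑ {n} (f ∘ toℕ)
sum-map-upTo f n = trans (cong List.sum (map-upTo f n)) (sum-applyUpTo f n)

≤-sum-tabulate : ∀ {k} (f : Fin k → ℕ) j → f j ≤ List.sum (tabulate f)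
≤-sum-tabulate f zero    = m≤m+n _ _
≤-sum-tabulate f (suc j) = ≤-trans (≤-sum-tabulate (f ∘ suc) j) (m≤n+m _ _)

sum-map-cong : {f g : X → ℕ} → f ≗ g → ∀ xs → List.sum (map f xs) ≡ List.sum (map g xs)
sum-map-cong f≗g xs = cong List.sum (map-cong f≗g xs)

sum-map-zero : (f : X → ℕ) → (∀ x → f x ≡ 0) → ∀ xs → List.sum (map f xs) ≡ 0
sum-map-zero f f≡0 []       = refl
sum-map-zero f f≡0 (x ∷ xs) = cong₂ _+_ (f≡0 x) (sum-map-zero f f≡0 xs)

sum-map-filterᵇ : (f : X → ℕ) (p : X → Bool) (xs : List X) →
  List.sum (map f (filterᵇ p xs)) ≡ List.sum (map (λ x → if p x then f x else 0) xs)
sum-map-filterᵇ f p []       = refl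
sum-map-filterᵇ f p (x ∷ xs) with p x
... | true  = cong (f x +_) (sum-map-filterᵇ f p xs)
... | false = sum-map-filterᵇ f p xs

sum-map-concatMap : (f : Y → ℕ) (g : X → List Y) (xs : List X) →
  List.sum (map f (concatMap g xs)) ≡ List.sum (map (λ x → List.sum (map f (g x))) xs)
sum-map-concatMap f g []       = refl
sum-map-concatMap f g (x ∷ xs) = begin
  List.sum (map f (g x ++ concatMap g xs))
    ≡⟨ cong List.sum (map-++ f (g x) (concatMap g xs)) ⟩
  List.sum (map f (g x) ++ map f (concatMap g xs))
    ≡⟨ sum-++ (map f (g x)) _ ⟩
  List.sum (map f (g x)) + List.sum (map f (concatMap g xs))
    ≡⟨ cong (List.sum (map f (g x)) +_) (sum-map-concatMap f g xs) ⟩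
  List.sum (map f (g x)) + List.sum (map (λ x → List.sum (map f (g x))) xs) ∎
  where open ≡-Reasoning

-- g need not respect pointwise equality of functions, so the surviving term is
-- g f for some f ≗ f₀ rather than g f₀ itself.
sum-allFuns-single : ∀ l M (g : (Fin l → Fin M) → ℕ) (f₀ : Fin l → Fin M) →
  (∀ f i → f i ≢ f₀ i → g f ≡ 0) →
  ∃ λ f → f ≗ f₀ × List.sum (map g (allFuns l M)) ≡ g f
sum-allFuns-single zero    M g f₀ g≡0 = (λ ()) , (λ ()) , +-identityʳ _
sum-allFuns-single (suc l) M g f₀ g≡0 = consF (f₀ zero) f , f≗f₀ , sum≡
  where
  h : (Fin l → Fin M) → ℕ
  h f = ∑ (λ a → g (consF a f))
  h≡0 : ∀ f i → f i ≢ f₀ (suc i) → h f ≡ 0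
  h≡0 f i fi≢ = sum-ε +-0-monoid _ (λ a → g≡0 (consF a f) (suc i) fi≢)
  tail-single = sum-allFuns-single l M h (f₀ ∘ suc) h≡0
  f = proj₁ tail-single
  f≗f₀ : consF (f₀ zero) f ≗ f₀
  f≗f₀ zero    = refl
  f≗f₀ (suc i) = proj₁ (proj₂ tail-single) i
  sum≡ : List.sum (map g (allFuns (suc l) M)) ≡ g (consF (f₀ zero) f)
  sum≡ = begin
    List.sum (map g (allFuns (suc l) M))
      ≡⟨ sum-map-concatMap g (λ f → map (λ a → consF a f) (allFin M)) (allFuns l M) ⟩
    List.sum (map (λ f → List.sum (map g (map (λ a → consF a f) (allFin M)))) (allFuns l M))
      ≡⟨ sum-map-cong (λ f → sum-map-map-allFin g (λ a → consF a f)) (allFuns l M) ⟩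
    List.sum (map h (allFuns l M))
      ≡⟨ proj₂ (proj₂ tail-single) ⟩
    h f
      ≡⟨ sum-single +-0-monoid (λ a → g (consF a f)) (f₀ zero) (λ a a≢ → g≡0 (consF a f) zero a≢) ⟩
    g (consF (f₀ zero) f) ∎
    where open ≡-Reasoning

∏-^-fibreSum : ∀ {k l} (b : Fin k → Fin l) (m : Fin l → ℕ) (e : Fin k → ℕ) →
  ∏ (λ i → m i ^ ∑ (λ j → if b j ≟ᶠ i then e j else 0)) ≡ ∏ (λ j → m (b j) ^ e j)
∏-^-fibreSum {k} {l} b m e = begin
  ∏ (λ i → m i ^ ∑ (λ j → if b j ≟ᶠ i then e j else 0))
    ≡⟨ Multiplicative.sum-cong-≗ {l} (λ i → ^-∑ (m i) {k} _) ⟩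
  ∏ (λ i → ∏ (λ j → m i ^ (if b j ≟ᶠ i then e j else 0)))
    ≡⟨ Multiplicative.∑-comm {l} {k} _ ⟩
  ∏ (λ j → ∏ (λ i → m i ^ (if b j ≟ᶠ i then e j else 0)))
    ≡⟨ Multiplicative.sum-cong-≗ {k} (λ j → sum-single *-1-monoid _ (b j) (λ i i≢bj →
         cong (m i ^_) (if-≟ᶠ-≢ (e j) 0 (i≢bj ∘ sym)))) ⟩
  ∏ (λ j → m (b j) ^ (if b j ≟ᶠ b j then e j else 0))
    ≡⟨ Multiplicative.sum-cong-≗ {k} (λ j → cong (m (b j) ^_) (if-≟ᶠ-refl (b j) (e j) 0)) ⟩
  ∏ (λ j → m (b j) ^ e j) ∎
  where open ≡-Reasoning

atIndex : ∀ {k} → (Fin k → Bool) → ℕ → Bool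
atIndex {zero}  q t       = false
atIndex {suc k} q zero    = q zero
atIndex {suc k} q (suc t) = atIndex (q ∘ suc) t

atIndex-cong : ∀ {k} {q q′ : Fin k → Bool} → q ≗ q′ → ∀ t → atIndex q t ≡ atIndex q′ t
atIndex-cong {zero}  q≗q′ t       = refl
atIndex-cong {suc k} q≗q′ zero    = q≗q′ zero
atIndex-cong {suc k} q≗q′ (suc t) = atIndex-cong (q≗q′ ∘ suc) t

any-false : (xs : List X) → any (λ _ → false) xs ≡ false
any-false []       = refl
any-false (x ∷ xs) = any-false xs

any-allFin-suc : ∀ {k} (p : Fin (suc k) → Bool) → any p (allFin (suc k)) ≡ p zero ∨ any (p ∘ suc) (allFin k)
any-allFin-suc p = cong (λ xs → p zero ∨ or xs)
  (trans (map-tabulate suc p) (sym (map-tabulate (λ i → i) (p ∘ suc))))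

any-≡ᵇ-∧ : ∀ {k} (q : Fin k → Bool) t → any (λ j → (toℕ j ≡ᵇ t) ∧ q j) (allFin k) ≡ atIndex q t
any-≡ᵇ-∧ {zero}  q t       = refl
any-≡ᵇ-∧ {suc k} q zero    = begin
  any (λ j → (toℕ j ≡ᵇ 0) ∧ q j) (allFin (suc k))  ≡⟨ any-allFin-suc {k} _ ⟩
  q zero ∨ any (λ _ → false) (allFin k)            ≡⟨ cong (q zero ∨_) (any-false (allFin k)) ⟩
  q zero ∨ false                                   ≡⟨ ∨-identityʳ (q zero) ⟩
  q zero                                           ∎
  where open ≡-Reasoning
any-≡ᵇ-∧ {suc k} q (suc t) =
  trans (any-allFin-suc (λ j → (toℕ j ≡ᵇ suc t) ∧ q j)) (any-≡ᵇ-∧ (q ∘ suc) t)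

-- ascent n j = [n_j < n_(j+1)] and descent n j = [n_j ≤ n_(j-1)], false at the ends.
ascent : ∀ {k} → (Fin k → ℕ) → Fin k → Bool
ascent n j = atIndex (λ j′ → n j <ᵇ n j′) (suc (toℕ j))

descent : ∀ {k} → (Fin k → ℕ) → Fin k → Bool
descent n zero    = false
descent n (suc j) = atIndex (λ j′ → n (suc j) ≤ᵇ n j′) (toℕ j)

fplus≡ascent : ∀ {k l} (n : Fin k → ℕ) (b : Fin k → Fin l) →
  (∀ j j′ → (toℕ (b j′) <ᵇ toℕ (b j)) ≡ (n j <ᵇ n j′)) →
  ∀ j → fplus b j ≡ iverson (ascent n j)
fplus≡ascent n b b<b≡n<n j = cong iverson (trans
  (any-≡ᵇ-∧ (λ j′ → toℕ (b j′) <ᵇ toℕ (b j)) (suc (toℕ j)))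
  (atIndex-cong (b<b≡n<n j) (suc (toℕ j))))

fminus≡descent : ∀ {k l} (n : Fin k → ℕ) (b : Fin k → Fin l) →
  (∀ j j′ → (toℕ (b j′) ≤ᵇ toℕ (b j)) ≡ (n j ≤ᵇ n j′)) →
  ∀ j → fminus b j ≡ iverson (descent n j)
fminus≡descent {k} n b b≤b≡n≤n zero    = cong iverson (any-false (allFin k))
fminus≡descent     n b b≤b≡n≤n (suc j) = cong iverson (trans
  (any-≡ᵇ-∧ (λ j′ → toℕ (b j′) ≤ᵇ toℕ (b (suc j))) (toℕ j))
  (atIndex-cong (b≤b≡n≤n (suc j)) (toℕ j)))

^-iverson-⊓ : ∀ a b → a ^ iverson (a <ᵇ b) * b ^ iverson (b ≤ᵇ a) ≡ a ⊓ b
^-iverson-⊓ a b with a <ᵇ b in a<ᵇb | b ≤ᵇ a in b≤ᵇa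
... | true  | true  = contradiction (≤ᵇ⇒≤ b a (Equivalence.from T-≡ b≤ᵇa))
                                    (<⇒≱ (<ᵇ⇒< a b (Equivalence.from T-≡ a<ᵇb)))
... | true  | false = trans (*-identityʳ (a * 1)) (trans (*-identityʳ a)
  (sym (m≤n⇒m⊓n≡m (<⇒≤ (<ᵇ⇒< a b (Equivalence.from T-≡ a<ᵇb))))))
... | false | true  = trans (*-identityˡ (b * 1)) (trans (*-identityʳ b)
  (sym (m≥n⇒m⊓n≡n (≤ᵇ⇒≤ b a (Equivalence.from T-≡ b≤ᵇa)))))
... | false | false = ⊥-elim (subst T b≤ᵇa (≤⇒≤ᵇ (≮⇒≥ {a} {b} (λ a<b → subst T a<ᵇb (<⇒<ᵇ a<b)))))

-- The pair (j, j+1) contributes n_j through the ascent of j if n_j < n_(j+1),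
-- and n_(j+1) through the descent of j+1 otherwise.
∏-ascent-descent : ∀ {k} (n : Fin k → ℕ) →
  ∏ (λ j → n j ^ iverson (ascent n j)) * ∏ (λ j → n j ^ iverson (descent n j)) ≡ adjMinProd (tabulate n)
∏-ascent-descent {zero}        n = refl
∏-ascent-descent {suc zero}    n = refl
∏-ascent-descent {suc (suc k)} n = begin
  (n₀ ^ iverson (n₀ <ᵇ n₁) * ascents) * (1 * (n₁ ^ iverson (n₁ ≤ᵇ n₀) * descents))
    ≡⟨ regroup (n₀ ^ iverson (n₀ <ᵇ n₁)) ascents (n₁ ^ iverson (n₁ ≤ᵇ n₀)) descents ⟩
  (n₀ ^ iverson (n₀ <ᵇ n₁) * n₁ ^ iverson (n₁ ≤ᵇ n₀)) * (ascents * (1 * descents))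
    ≡⟨ cong₂ _*_ (^-iverson-⊓ n₀ n₁) (∏-ascent-descent (n ∘ suc)) ⟩
  (n₀ ⊓ n₁) * adjMinProd (tabulate (n ∘ suc)) ∎
  where
  open ≡-Reasoning
  n₀ = n zero
  n₁ = n (suc zero)
  ascents = ∏ (λ j → n (suc j) ^ iverson (ascent (n ∘ suc) j))
  descents = ∏ (λ j → n (suc (suc j)) ^ iverson (descent (n ∘ suc) (suc j)))
  regroup : ∀ p a q d → (p * a) * (1 * (q * d)) ≡ (p * q) * (a * (1 * d))
  regroup = solve-∀

Decreasing : ∀ {l} → (Fin l → ℕ) → Set
Decreasing m = m Preserves _<ᶠ_ ⟶ _>_

module _ {l} {m : Fin l → ℕ} (m↓ : Decreasing m) where

  decreasing-reflects-< : ∀ {i i′} → m i′ < m i → i <ᶠ i′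
  decreasing-reflects-< {i} {i′} m<m with <-cmp (toℕ i) (toℕ i′)
  ... | tri< i<i′ _ _ = i<i′
  ... | tri≈ _ i≡i′ _ = contradiction (subst (λ x → m i′ < m x) (Fin.toℕ-injective i≡i′) m<m) (<-irrefl refl)
  ... | tri> _ _ i>i′ = contradiction (m↓ i>i′) (<-asym m<m)

  decreasing-injective : Injective _≡_ _≡_ m
  decreasing-injective {i} {i′} mi≡mi′ with <-cmp (toℕ i) (toℕ i′)
  ... | tri< i<i′ _ _ = contradiction (m↓ i<i′) (<-irrefl (sym mi≡mi′))
  ... | tri≈ _ i≡i′ _ = Fin.toℕ-injective i≡i′
  ... | tri> _ _ i>i′ = contradiction (m↓ i>i′) (<-irrefl mi≡mi′)

  <ᵇ-antitone : ∀ i i′ → (toℕ i <ᵇ toℕ i′) ≡ (m i′ <ᵇ m i)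
  <ᵇ-antitone i i′ = T-injective
    (<⇒<ᵇ ∘ m↓ ∘ <ᵇ⇒< _ _)
    (<⇒<ᵇ ∘ decreasing-reflects-< ∘ <ᵇ⇒< _ _)

  ≤ᵇ-antitone : ∀ i i′ → (toℕ i ≤ᵇ toℕ i′) ≡ (m i′ ≤ᵇ m i)
  ≤ᵇ-antitone i i′ = T-injective
    (λ i≤i′ → ≤⇒≤ᵇ (≮⇒≥ (λ mi<mi′ → <⇒≱ (decreasing-reflects-< mi<mi′) (≤ᵇ⇒≤ _ _ i≤i′))))
    (λ mi′≤mi → ≤⇒≤ᵇ (≮⇒≥ (λ i′<i → <⇒≱ (m↓ i′<i) (≤ᵇ⇒≤ _ _ mi′≤mi))))

T-strictDecr : ∀ {l} (m : Fin l → ℕ) → T (strictDecr m) ⇔ Decreasing m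
T-strictDecr m = mk⇔
  (λ t {i} {i′} i<i′ → <ᵇ⇒< _ _ (if-true (<⇒<ᵇ i<i′)
     (Equivalence.to (T-all-allFin _) (Equivalence.to (T-all-allFin _) t i) i′)))
  (λ m↓ → Equivalence.from (T-all-allFin _) λ i → Equivalence.from (T-all-allFin _) (ordered m↓ i))
  where
  if-true : ∀ {c x} → T c → T (if c then x else true) → T x
  if-true {true} _ t = t
  ordered : Decreasing m → ∀ i i′ → T (if toℕ i <ᵇ toℕ i′ then m i′ <ᵇ m i else true)
  ordered m↓ i i′ with toℕ i <ᵇ toℕ i′ in i<ᵇi′
  ... | true  = <⇒<ᵇ (m↓ (<ᵇ⇒< _ _ (Equivalence.from T-≡ i<ᵇi′)))
  ... | false = _

record Compatible {k l} (n : Fin k → ℕ) (b : Fin k → Fin l) (m : Fin l → ℕ) : Set where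
  field
    decreasing : Decreasing m
    factorises : ∀ j → m (b j) ≡ n j
open Compatible

T-zetaCondition : ∀ {k l} (n : Fin k → ℕ) (b : Fin k → Fin l) (m : Fin l → ℕ) →
  T (strictDecr m ∧ all (λ j → m (b j) ≡ᵇ n j) (allFin k)) ⇔ Compatible n b m
T-zetaCondition n b m = mk⇔
  (λ t → let t↓ , t≡ = Equivalence.to T-∧ t in record
    { decreasing = Equivalence.to (T-strictDecr m) t↓
    ; factorises = λ j → ≡ᵇ⇒≡ _ _ (Equivalence.to (T-all-allFin _) t≡ j) })
  (λ c → Equivalence.from T-∧
    ( Equivalence.from (T-strictDecr m) (decreasing c)
    , Equivalence.from (T-all-allFin _) (λ j → ≡⇒≡ᵇ _ _ (factorises c j))))

product-^-shift : ∀ {k l} {n : Fin k → ℕ} {b : Fin k → Fin l} {m : Fin l → ℕ} → Compatible n b m →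
  List.product (map (λ i → m i ^ shift b i) (allFin l)) ≡ adjMinProd (tabulate n)
product-^-shift {k} {l} {n} {b} {m} c = begin
  List.product (map (λ i → m i ^ shift b i) (allFin l))
    ≡⟨ product-map-allFin (λ i → m i ^ shift b i) ⟩
  ∏ (λ i → m i ^ shift b i)
    ≡⟨ Multiplicative.sum-cong-≗ {l} (λ i → cong (m i ^_) (sum-map-allFin (λ j → if b j ≟ᶠ i then e j else 0))) ⟩
  ∏ (λ i → m i ^ ∑ (λ j → if b j ≟ᶠ i then e j else 0))
    ≡⟨ ∏-^-fibreSum b m e ⟩
  ∏ (λ j → m (b j) ^ e j)
    ≡⟨ Multiplicative.sum-cong-≗ {k} (λ j → cong₂ _^_ (factorises c j) (cong₂ _+_ (f⁺ j) (f⁻ j))) ⟩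
  ∏ (λ j → n j ^ (iverson (ascent n j) + iverson (descent n j)))
    ≡⟨ Multiplicative.sum-cong-≗ {k} (λ j → ^-distribˡ-+-* (n j) (iverson (ascent n j)) (iverson (descent n j))) ⟩
  ∏ (λ j → n j ^ iverson (ascent n j) * n j ^ iverson (descent n j))
    ≡⟨ Multiplicative.∑-distrib-+ {k} _ _ ⟩
  ∏ (λ j → n j ^ iverson (ascent n j)) * ∏ (λ j → n j ^ iverson (descent n j))
    ≡⟨ ∏-ascent-descent n ⟩
  adjMinProd (tabulate n) ∎
  where
  open ≡-Reasoning
  e : Fin k → ℕ
  e j = fplus b j + fminus b j
  f⁺ : ∀ j → fplus b j ≡ iverson (ascent n j)
  f⁺ = fplus≡ascent n b λ j j′ →
    trans (<ᵇ-antitone (decreasing c) (b j′) (b j)) (cong₂ _<ᵇ_ (factorises c j) (factorises c j′))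
  f⁻ : ∀ j → fminus b j ≡ iverson (descent n j)
  f⁻ = fminus≡descent n b λ j j′ →
    trans (≤ᵇ-antitone (decreasing c) (b j′) (b j)) (cong₂ _≤ᵇ_ (factorises c j) (factorises c j′))

zetaTerm-compatible : ∀ {k l} {n : Fin k → ℕ} {b : Fin k → Fin l} {m : Fin l → ℕ} →
  Compatible n b m → zetaTerm (osp l b) n m ≡ adjMinProd (tabulate n)
zetaTerm-compatible {n = n} {b} {m} c =
  trans (if-T _ 0 (Equivalence.from (T-zetaCondition n b m) c)) (product-^-shift c)

zetaTerm-incompatible : ∀ {k l} {n : Fin k → ℕ} {b : Fin k → Fin l} {m : Fin l → ℕ} →
  ¬ Compatible n b m → zetaTerm (osp l b) n m ≡ 0
zetaTerm-incompatible {n = n} {b} {m} ¬c = if-¬T _ 0 (¬c ∘ Equivalence.to (T-zetaCondition n b m))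

strictlyDecreasing-≡ : ∀ {xs ys} → AllPairs _>_ xs → AllPairs _>_ ys → xs ⊆ ys → ys ⊆ xs → xs ≡ ys
strictlyDecreasing-≡ {[]}     {[]}     _ _ _ _ = refl
strictlyDecreasing-≡ {[]}     {y ∷ ys} _ _ _ ys⊆xs with () ← ys⊆xs (here refl)
strictlyDecreasing-≡ {x ∷ xs} {[]}     _ _ xs⊆ys _ with () ← xs⊆ys (here refl)
strictlyDecreasing-≡ {x ∷ xs} {y ∷ ys} (x>xs ∷ xs↓) (y>ys ∷ ys↓) xs⊆ys ys⊆xs =
  cong₂ _∷_ x≡y (strictlyDecreasing-≡ xs↓ ys↓ (tail⊆ x>xs xs⊆ys x≡y) (tail⊆ y>ys ys⊆xs (sym x≡y)))
  where
  x≡y : x ≡ y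
  x≡y with xs⊆ys (here refl) | ys⊆xs (here refl)
  ... | here x≡y   | _          = x≡y
  ... | there _    | here y≡x   = sym y≡x
  ... | there x∈ys | there y∈xs = contradiction (All.lookup y>ys x∈ys) (<-asym (All.lookup x>xs y∈xs))
  tail⊆ : ∀ {u us v vs} → All (u >_) us → u ∷ us ⊆ v ∷ vs → u ≡ v → us ⊆ vs
  tail⊆ u>us ⊆ u≡v w∈us with ⊆ (there w∈us)
  ... | here w≡v   = contradiction (subst (_ >_) (trans w≡v (sym u≡v)) (All.lookup u>us w∈us)) (<-irrefl refl)
  ... | there w∈vs = w∈vs

AllPairs-lookup : ∀ {R : ℕ → ℕ → Set} {xs} → AllPairs R xs → ∀ {i j} → i <ᶠ j → R (lookup xs i) (lookup xs j)
AllPairs-lookup (Rx ∷ _)  {zero}  {suc j} _         = All.lookup Rx (∈-lookup j)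
AllPairs-lookup (_ ∷ xs↓) {suc i} {suc j} (s≤s i<j) = AllPairs-lookup xs↓ i<j

tabulate-injective : ∀ {l} {f g : Fin l → X} → tabulate f ≡ tabulate g → f ≗ g
tabulate-injective {l = suc l} eq zero    = proj₁ (∷-injective eq)
tabulate-injective {l = suc l} eq (suc i) = tabulate-injective (proj₂ (∷-injective eq)) i

-- A term Π_i m_i^(-e_i) of ζ_S, with S given by its block map, whose monomial
-- Π_j n_j^(-x_j) has heights n.
record Realisation {k} (n : Fin k → ℕ) (l : ℕ) : Set where
  field
    blockOf    : Fin k → Fin l
    valueOf    : Fin l → ℕ
    onto       : StrictlySurjective _≡_ blockOf
    compatible : Compatible n blockOf valueOf
open Realisation

module _ {k} {n : Fin k → ℕ} where

  valueOf-attained : ∀ {l} (r : Realisation n l) i → ∃ λ j → n j ≡ valueOf r i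
  valueOf-attained r i = let j , bj≡i = onto r i in
    j , trans (sym (factorises (compatible r) j)) (cong (valueOf r) bj≡i)

  ∈-tabulate-valueOf : ∀ {l} (r : Realisation n l) {v} → v ∈ tabulate (valueOf r) ⇔ ∃ λ j → n j ≡ v
  ∈-tabulate-valueOf r = mk⇔
    (λ v∈ → let i , v≡ = ∈-tabulate⁻ v∈ ; j , nj≡ = valueOf-attained r i in j , trans nj≡ (sym v≡))
    (λ (j , nj≡v) → subst (_∈ tabulate (valueOf r)) (trans (factorises (compatible r) j) nj≡v)
                          (∈-tabulate⁺ (blockOf r j)))

  tabulate-valueOf : ∀ {l l′} (r : Realisation n l) (r′ : Realisation n l′) →
    tabulate (valueOf r) ≡ tabulate (valueOf r′)
  tabulate-valueOf r r′ = strictlyDecreasing-≡ (↓ r) (↓ r′)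
    (Equivalence.from (∈-tabulate-valueOf r′) ∘ Equivalence.to (∈-tabulate-valueOf r))
    (Equivalence.from (∈-tabulate-valueOf r) ∘ Equivalence.to (∈-tabulate-valueOf r′))
    where
    ↓ : ∀ {l} (r : Realisation n l) → AllPairs _>_ (tabulate (valueOf r))
    ↓ r = AllPairs.tabulate⁺-< (decreasing (compatible r))

  realisation-size : ∀ {l l′} → Realisation n l → Realisation n l′ → l ≡ l′
  realisation-size r r′ = trans (sym (length-tabulate (valueOf r)))
    (trans (cong length (tabulate-valueOf r r′)) (length-tabulate (valueOf r′)))

  realisation-unique : ∀ {l} (r r′ : Realisation n l) → valueOf r ≗ valueOf r′ × blockOf r ≗ blockOf r′
  realisation-unique r r′ = value≗ , λ j → decreasing-injective (decreasing (compatible r))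
    (trans (factorises (compatible r) j) (trans (sym (factorises (compatible r′) j)) (sym (value≗ (blockOf r′ j)))))
    where
    value≗ = tabulate-injective (tabulate-valueOf r r′)

  realisation-size≤ : ∀ {l} → Realisation n l → l ≤ k
  realisation-size≤ r = Fin.injective⇒≤ {f = proj₁ ∘ onto r} λ {i} {i′} eq →
    trans (sym (proj₂ (onto r i))) (trans (cong (blockOf r) eq) (proj₂ (onto r i′)))

module _ {k} (n : Fin k → ℕ) {B} (n≤B : ∀ j → n j ≤ B) where

  isHeight? : Decidable (λ v → ∃ λ j → n j ≡ v)
  isHeight? v = Fin.any? (λ j → n j ≟ v)

  heights : List ℕ
  heights = filter isHeight? (downFrom (suc B))

  heights↓ : AllPairs _>_ heights
  heights↓ = AllPairs.filter⁺ isHeight? (AllPairs.applyDownFrom⁺₁ (λ v → v) (suc B) (λ j<i _ → j<i))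

  ∈-heights : ∀ j → n j ∈ heights
  ∈-heights j = ∈-filter⁺ isHeight? {xs = downFrom (suc B)} (∈-downFrom⁺ (s≤s (n≤B j))) (j , refl)

  canonical : Realisation n (length heights)
  canonical = record
    { blockOf    = index ∘ ∈-heights
    ; valueOf    = lookup heights
    ; onto       = onto′
    ; compatible = compatible′
    }
    where
    compatible′ : Compatible n (index ∘ ∈-heights) (lookup heights)
    compatible′ = record
      { decreasing = AllPairs-lookup heights↓
      ; factorises = λ j → sym (Any.lookup-index (∈-heights j))
      }
    onto′ : StrictlySurjective _≡_ (index ∘ ∈-heights)
    onto′ i with ∈-filter⁻ isHeight? {xs = downFrom (suc B)} (∈-lookup i)
    ... | _ , j , nj≡ = j , decreasing-injective (decreasing compatible′) (trans (factorises compatible′ j) nj≡)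

nonempty-realisation : ∀ {k} (n : Fin (suc k) → ℕ) → ∃ λ L → L < suc k × Realisation n (suc L)
nonempty-realisation n = shrink (canonical n (≤-sum-tabulate n))
  where
  shrink : ∀ {l} → Realisation n l → ∃ λ L → L < _ × Realisation n (suc L)
  shrink {zero}  r = ⊥-elim (Fin.¬Fin0 (blockOf r zero))
  shrink {suc L} r = L , realisation-size≤ r , r

module _ {k} (n : Fin k → ℕ) where

  B : ℕ
  B = List.sum (tabulate n)

  contribution : ∀ l → (Fin k → Fin l) → ℕ
  contribution l b = if isSurj b then Zeta (osp l b) n else 0

  contribution-vanishes : ∀ {l} (b : Fin k → Fin l) →
    (∀ m → StrictlySurjective _≡_ b → Compatible n b m → ⊥) → contribution l b ≡ 0
  contribution-vanishes {l} b none with isSurj b in surj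
  ... | false = refl
  ... | true  = sum-map-zero _ (λ m′ → zetaTerm-incompatible (none _ b-onto)) (allFuns l B)
    where b-onto = Equivalence.to (T-isSurj b) (Equivalence.from T-≡ surj)

  sum-contributions-vanish : ∀ {l l′} → Realisation n l′ → l ≢ l′ →
    List.sum (map (contribution l) (allFuns k l)) ≡ 0
  sum-contributions-vanish {l} r l≢l′ = sum-map-zero _ (λ b → contribution-vanishes b λ m b-onto c →
    l≢l′ (realisation-size (record { blockOf = b ; valueOf = m ; onto = b-onto ; compatible = c }) r))
    (allFuns k l)

  module _ (n≥1 : ∀ j → 1 ≤ n j) where

    -- Zeta sums over m_i = 1 + toℕ m′_i with m′_i : Fin B, so v ∈ [1, B] is coded by v - 1.
    code : ∀ {v} → 1 ≤ v → v ≤ B → Fin B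
    code {suc v} _ v<B = fromℕ< v<B

    suc-toℕ-code : ∀ {v} (1≤v : 1 ≤ v) (v≤B : v ≤ B) → suc (toℕ (code 1≤v v≤B)) ≡ v
    suc-toℕ-code {suc v} _ v<B = cong suc (Fin.toℕ-fromℕ< v<B)

    Zeta-realisation : ∀ {l} (r : Realisation n l) → Zeta (osp l (blockOf r)) n ≡ adjMinProd (tabulate n)
    Zeta-realisation {l} r = trans (proj₂ (proj₂ single)) (zetaTerm-compatible (record
      { decreasing = λ i<i′ → subst₂ _<_ (sym (decode≗ _)) (sym (decode≗ _)) (decreasing (compatible r) i<i′)
      ; factorises = λ j → trans (decode≗ _) (factorises (compatible r) j) }))
      where
      decode : (Fin l → Fin B) → Fin l → ℕ
      decode m′ i = suc (toℕ (m′ i))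
      term : (Fin l → Fin B) → ℕ
      term m′ = zetaTerm (osp l (blockOf r)) n (decode m′)
      coded : Fin l → Fin B
      coded i = let j , nj≡ = valueOf-attained r i in
        code (subst (1 ≤_) nj≡ (n≥1 j)) (subst (_≤ B) nj≡ (≤-sum-tabulate n j))
      vanish : ∀ m′ i → m′ i ≢ coded i → term m′ ≡ 0
      vanish m′ i m′i≢ = zetaTerm-incompatible λ c → m′i≢ (Fin.toℕ-injective (suc-injective (trans
        (proj₁ (realisation-unique (record { blockOf = blockOf r ; valueOf = decode m′ ; onto = onto r ; compatible = c }) r) i)
        (sym (suc-toℕ-code _ _)))))
      single = sum-allFuns-single l B term coded vanish
      decode≗ : decode (proj₁ single) ≗ valueOf r
      decode≗ i = trans (cong (suc ∘ toℕ) (proj₁ (proj₂ single) i)) (suc-toℕ-code _ _)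

    sum-contributions : ∀ {l} → Realisation n l →
      List.sum (map (contribution l) (allFuns k l)) ≡ adjMinProd (tabulate n)
    sum-contributions {l} r = begin
      List.sum (map (contribution l) (allFuns k l)) ≡⟨ proj₂ (proj₂ single) ⟩
      contribution l b                              ≡⟨ if-T _ 0 (Equivalence.from (T-isSurj b) (onto r′)) ⟩
      Zeta (osp l b) n                              ≡⟨ Zeta-realisation r′ ⟩
      adjMinProd (tabulate n)                       ∎
      where
      open ≡-Reasoning
      vanish : ∀ b j → b j ≢ blockOf r j → contribution l b ≡ 0
      vanish b j bj≢ = contribution-vanishes b λ m b-onto c → bj≢
        (proj₂ (realisation-unique (record { blockOf = b ; valueOf = m ; onto = b-onto ; compatible = c }) r) j)
      single = sum-allFuns-single k l (contribution l) (blockOf r) vanish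
      b = proj₁ single
      b≗ = proj₁ (proj₂ single)
      r′ : Realisation n l
      r′ = record
        { blockOf    = b
        ; valueOf    = valueOf r
        ; onto       = λ i → let j , bj≡i = onto r i in j , trans (b≗ j) bj≡i
        ; compatible = record
          { decreasing = decreasing (compatible r)
          ; factorises = λ j → trans (cong (valueOf r) (b≗ j)) (factorises (compatible r) j) } }

RHS-contributions : ∀ k (n : Fin k → ℕ) →
  RHS k n ≡ List.sum (map (λ l → List.sum (map (contribution n (suc l)) (allFuns k (suc l)))) (upTo k))
RHS-contributions k n = begin
  List.sum (map (λ F → F n) (map Zeta (orderedSetPartitions k)))
    ≡⟨ cong List.sum (sym (map-∘ (orderedSetPartitions k))) ⟩
  List.sum (map (λ p → Zeta p n) (orderedSetPartitions k))
    ≡⟨ sum-map-concatMap (λ p → Zeta p n) partitions (upTo k) ⟩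
  List.sum (map (λ l → List.sum (map (λ p → Zeta p n) (partitions l))) (upTo k))
    ≡⟨ sum-map-cong (λ l → trans (cong List.sum (sym (map-∘ (surjections l))))
                                (sum-map-filterᵇ (λ b → Zeta (osp (suc l) b) n) isSurj (allFuns k (suc l))))
                    (upTo k) ⟩
  List.sum (map (λ l → List.sum (map (contribution n (suc l)) (allFuns k (suc l)))) (upTo k)) ∎
  where
  open ≡-Reasoning
  surjections : ∀ l → List (Fin k → Fin (suc l))
  surjections l = filterᵇ isSurj (allFuns k (suc l))
  partitions : ℕ → List (OSP k)
  partitions l = map (osp (suc l)) (surjections l)

theorem1 : (k : ℕ) → 1 ≤ k → (n : Fin k → ℕ) → (∀ j → 1 ≤ n j) →
    V k n ≡ RHS k n
theorem1 zero    ()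
theorem1 (suc k) _ n n≥1 = sym (begin
  RHS (suc k) n                    ≡⟨ RHS-contributions (suc k) n ⟩
  List.sum (map G (upTo (suc k)))  ≡⟨ sum-map-upTo G (suc k) ⟩
  ∑ {suc k} (G ∘ toℕ)              ≡⟨ sum-single +-0-monoid {suc k} (G ∘ toℕ) (fromℕ< L<k) others ⟩
  G (toℕ (fromℕ< L<k))             ≡⟨ cong G (Fin.toℕ-fromℕ< L<k) ⟩
  G L                              ≡⟨ sum-contributions n n≥1 r ⟩
  adjMinProd (tabulate n)          ∎)
  where
  open ≡-Reasoning
  G : ℕ → ℕ
  G l = List.sum (map (contribution n (suc l)) (allFuns (suc k) (suc l)))
  L = proj₁ (nonempty-realisation n)
  L<k = proj₁ (proj₂ (nonempty-realisation n))
  r = proj₂ (proj₂ (nonempty-realisation n))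
  others : ∀ l → l ≢ fromℕ< L<k → G (toℕ l) ≡ 0
  others l l≢ = sum-contributions-vanish n r λ eq →
    l≢ (Fin.toℕ-injective (trans (suc-injective eq) (sym (Fin.toℕ-fromℕ< L<k))))
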